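{- Let $\mathcal{T}_0=\{T^\flat,T^\dagger,T^\ddagger,T^\sharp\}$ and $\mathcal{T}_{k+1}=\{S\otimes T: S,T\in\mathcal{T}_k\}$ for $k\geqslant0$. Let $k\geqslant 0$, $T\in\mathcal{T}_k$ and $d=\delta(T)$. Put $\delta^\flat_k=3\cdot2^k+k+1$, $g^\flat_k=3\cdot 2^k$ and $n^\flat_k=\frac92\cdot4^k+\frac92\cdot2^k$. Then $$n(T)=n^\flat_k+g^\flat_k(d-\delta^\flat_k)+\frac{(d-\delta^\flat_k)(d-\delta^\flat_k-1)}{2}$$ and $$g(T)=g^\flat_k+d-\delta^\flat_k=d-k-1.$$
   Context: Let $S=\{0,1,*\}$; elements of $S^d$ are strings of length $d$. A list is a finite sequence of strings all of the same length (repetitions allowed); $|L|$ is its number of entries; $[x]$ is the one-entry list of the string $x$; $*^m$ is the string of $m$ jokers $*$. Operations: pairing $[v_1,\dots,v_n]\ominus[w_1,\dots,w_n]=[v_1w_1,\dots,v_nw_n]$; concatenation $AB=[v_iw_j]$ (all pairs, ordered lexicographically in $(i,j)$); sum $A+B$ = entries of $A$ followed by entries of $B$; $1\cdot A=A$, $(k+1)\cdot A=k\cdot A+A$; concatenation before sum. For a triple of lists $T=(A,B,C)$: $\alpha(T)$, $\beta(T)$ are the lengths of the strings in $A$, $B$; $\delta(T)=\alpha(T)+\beta(T)$; $n(T)=|A|$; $g(T)=|C|$. The compound of triples $T=(A,B,C)$, $T'=(A',B',C')$ with $\alpha(T)=\alpha(T')$ is $T\otimes T'=(A'',B'',C'')$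 with $A''=[0]A+[0]A'+[1]\big((g(T)g(T'))\cdot[*^{\alpha(T)}]\big)$, $B''=[0]B[*^{\beta(T')}]+[1][*^{\beta(T)}]B'+[*]CC'$, $C''=[0]C[*^{\beta(T')}]+[1][*^{\beta(T)}]C'$. Let $G=[0,1]$, $H=[00,01,1*]$, $L=[000,001,01*,1**]$. Define $T^\flat=(3\cdot[00]+3\cdot[01]+3\cdot[1*],\ 3\cdot H,\ H)$; $T^\dagger=(4\cdot[00]+4\cdot[01]+4\cdot[1*],\ 3\cdot L,\ L)$; $T^\ddagger=(2\cdot[00]+2\cdot[01]+3\cdot[00]+3\cdot[01]+6\cdot[1*],\ 2\cdot([0]G[**])+2\cdot([1][*]H)+[*]GH,\ [0]G[**]+[1][*]H)$; $T^\sharp=(2\cdot(3\cdot[00]+3\cdot[01])+9\cdot[1*],\ 2\cdot([0]H[**])+2\cdot([1][**]H)+[*]HH,\ [0]H[**]+[1][**]H)$. -}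

module Defs where

open import Data.Nat using (ℕ; zero; suc; _+_; _*_; _^_)
open import Data.List using (List; []; _∷_; _++_; map; concatMap; length; replicate)
open import Relation.Binary.PropositionalEquality using (_≡_)

data Sym : Set where
  s0 s1 sj : Sym

Str : Set
Str = List Sym

Lst : Set
Lst = List Str

⟦_⟧ : Str → Lst
⟦ x ⟧ = x ∷ []

jokers : ℕ → Str
jokers m = replicate m sj

infixl 7 _⊙_
_⊙_ : Lst → Lst → Lst
A ⊙ B = concatMap (λ v → map (λ w → v ++ w) B) A

infixl 6 _⊕_
_⊕_ : Lst → Lst → Lst
A ⊕ B = A ++ B

-- k·A  (1·A = A, (k+1)·A = k·A + A; we also set 0·A = [] which is never used)
infixr 7 _·_
_·_ : ℕ → Lst → Lst
zero · A = []
suc k · A = k · A ⊕ A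

record Triple : Set where
  constructor triple
  field
    A B C : Lst
open Triple public

-- length of the strings of a list (the length of its first entry; 0 for the empty list)
strLen : Lst → ℕ
strLen [] = 0
strLen (x ∷ _) = length x

α : Triple → ℕ
α T = strLen (A T)

β : Triple → ℕ
β T = strLen (B T)

δ : Triple → ℕ
δ T = α T + β T

n : Triple → ℕ
n T = length (A T)

g : Triple → ℕ
g T = length (C T)

-- the compound T ⊗ T' (meaningful when α T ≡ α T')
_⊗_ : Triple → Triple → Triple
T ⊗ T' = triple A'' B'' C''
  where
    A'' = ⟦ s0 ∷ [] ⟧ ⊙ A T ⊕ ⟦ s0 ∷ [] ⟧ ⊙ A T'
            ⊕ ⟦ s1 ∷ [] ⟧ ⊙ ((g T * g T') · ⟦ jokers (α T) ⟧)
    B'' = ⟦ s0 ∷ [] ⟧ ⊙ B T ⊙ ⟦ jokers (β T') ⟧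
            ⊕ ⟦ s1 ∷ [] ⟧ ⊙ ⟦ jokers (β T) ⟧ ⊙ B T'
            ⊕ ⟦ sj ∷ [] ⟧ ⊙ C T ⊙ C T'
    C'' = ⟦ s0 ∷ [] ⟧ ⊙ C T ⊙ ⟦ jokers (β T') ⟧
            ⊕ ⟦ s1 ∷ [] ⟧ ⊙ ⟦ jokers (β T) ⟧ ⊙ C T'

G H L : Lst
G = ⟦ s0 ∷ [] ⟧ ⊕ ⟦ s1 ∷ [] ⟧
H = ⟦ s0 ∷ s0 ∷ [] ⟧ ⊕ ⟦ s0 ∷ s1 ∷ [] ⟧ ⊕ ⟦ s1 ∷ sj ∷ [] ⟧
L = ⟦ s0 ∷ s0 ∷ s0 ∷ [] ⟧ ⊕ ⟦ s0 ∷ s0 ∷ s1 ∷ [] ⟧ ⊕ ⟦ s0 ∷ s1 ∷ sj ∷ [] ⟧ ⊕ ⟦ s1 ∷ sj ∷ sj ∷ [] ⟧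

[00] [01] [1*] [**] [0] [1] [*] : Lst
[00] = ⟦ s0 ∷ s0 ∷ [] ⟧
[01] = ⟦ s0 ∷ s1 ∷ [] ⟧
[1*] = ⟦ s1 ∷ sj ∷ [] ⟧
[**] = ⟦ sj ∷ sj ∷ [] ⟧
[0] = ⟦ s0 ∷ [] ⟧
[1] = ⟦ s1 ∷ [] ⟧
[*] = ⟦ sj ∷ [] ⟧

T♭ T† T‡ T♯ : Triple
T♭ = triple (3 · [00] ⊕ 3 · [01] ⊕ 3 · [1*]) (3 · H) H
T† = triple (4 · [00] ⊕ 4 · [01] ⊕ 4 · [1*]) (3 · L) L
T‡ = triple (2 · [00] ⊕ 2 · [01] ⊕ 3 · [00] ⊕ 3 · [01] ⊕ 6 · [1*])
            (2 · ([0] ⊙ G ⊙ [**]) ⊕ 2 · ([1] ⊙ [*] ⊙ H) ⊕ [*] ⊙ G ⊙ H)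
            ([0] ⊙ G ⊙ [**] ⊕ [1] ⊙ [*] ⊙ H)
T♯ = triple (2 · (3 · [00] ⊕ 3 · [01]) ⊕ 9 · [1*])
            (2 · ([0] ⊙ H ⊙ [**]) ⊕ 2 · ([1] ⊙ [**] ⊙ H) ⊕ [*] ⊙ H ⊙ H)
            ([0] ⊙ H ⊙ [**] ⊕ [1] ⊙ [**] ⊙ H)

data 𝒯 : ℕ → Triple → Set where
  base♭ : 𝒯 0 T♭
  base† : 𝒯 0 T†
  base‡ : 𝒯 0 T‡
  base♯ : 𝒯 0 T♯
  step  : ∀ {k S T} → 𝒯 k S → 𝒯 k T → α S ≡ α T → 𝒯 (suc k) (S ⊗ T)

-- δ♭_k, g♭_k, and 2·n♭_k = 9·4^k + 9·2^k
δ♭ g♭ twice-n♭ : ℕ → ℕ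
δ♭ k = 3 * 2 ^ k + k + 1
g♭ k = 3 * 2 ^ k
twice-n♭ k = 9 * 4 ^ k + 9 * 2 ^ k

{-# OPTIONS --safe #-}
-- Under the compound, n ↦ n_S + n_T + g_S g_T and g ↦ g_S + g_T, while α grows by one and
-- β ↦ β_S + β_T + 1 (A and B stay nonempty, so α and β really are string lengths).  Hence every
-- T ∈ 𝒯_k has α = k + 2, β = g − 1 and 2n + g = g² + 12·2^k, the last because the cross term
-- 2 g_S g_T completes g_S² + g_T² to (g_S + g_T)² while 12·2^k doubles.  So d = g + k + 1, and
-- 2n = g² − g + 12·2^k rewritten in x = d − δ♭_k = g − 3·2^k is the stated closed form.
module Submission where

open import Defs
open import Data.Nat using (ℕ)
open import Data.Integer using (ℤ; +_; _+_; _-_; _*_)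
open import Data.Product using (_×_)
open import Relation.Binary.PropositionalEquality using (_≡_)

import Data.Nat as ℕ
import Data.Nat.Properties as ℕ
import Data.Nat.Tactic.RingSolver as ℕ-Solver
open import Data.Integer.Properties using (pos-+; pos-*)
open import Data.Integer.Tactic.RingSolver using (solve-∀)
open import Data.List using (List; []; _∷_; _++_; map; length)
open import Data.List.Properties using (length-++; length-map; length-replicate)
open import Data.Product using (_,_)
open import Relation.Binary.PropositionalEquality using (refl; sym; trans; cong; cong₂; module ≡-Reasoning)

data NonEmpty {X : Set} : List X → Set where
  _∷_ : ∀ x xs → NonEmpty (x ∷ xs)

length-⊙ : ∀ X Y → length (X ⊙ Y) ≡ length X ℕ.* length Y
length-⊙ []      Y = refl
length-⊙ (x ∷ X) Y = begin
  length (map (x ++_) Y ++ X ⊙ Y)          ≡⟨ length-++ (map (x ++_) Y) ⟩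
  length (map (x ++_) Y) ℕ.+ length (X ⊙ Y) ≡⟨ cong₂ ℕ._+_ (length-map (x ++_) Y) (length-⊙ X Y) ⟩
  length Y ℕ.+ length X ℕ.* length Y        ∎
  where open ≡-Reasoning

length-· : ∀ k X → length (k · X) ≡ k ℕ.* length X
length-· ℕ.zero    X = refl
length-· (ℕ.suc k) X = begin
  length (k · X ++ X)            ≡⟨ length-++ (k · X) ⟩
  length (k · X) ℕ.+ length X    ≡⟨ cong (ℕ._+ length X) (length-· k X) ⟩
  k ℕ.* length X ℕ.+ length X    ≡⟨ ℕ.+-comm (k ℕ.* length X) (length X) ⟩
  length X ℕ.+ k ℕ.* length X    ∎
  where open ≡-Reasoning

length-⟦⟧⊙ : ∀ x Y → length (⟦ x ⟧ ⊙ Y) ≡ length Y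
length-⟦⟧⊙ x Y = trans (length-⊙ ⟦ x ⟧ Y) (ℕ.*-identityˡ (length Y))

length-⊙⟦⟧ : ∀ X y → length (X ⊙ ⟦ y ⟧) ≡ length X
length-⊙⟦⟧ X y = trans (length-⊙ X ⟦ y ⟧) (ℕ.*-identityʳ (length X))

n-⊗ : ∀ S T → n (S ⊗ T) ≡ n S ℕ.+ n T ℕ.+ g S ℕ.* g T
n-⊗ S T = begin
  length ((X₁ ++ X₂) ++ X₃)               ≡⟨ length-++ (X₁ ++ X₂) ⟩
  length (X₁ ++ X₂) ℕ.+ length X₃          ≡⟨ cong (ℕ._+ length X₃) (length-++ X₁) ⟩
  length X₁ ℕ.+ length X₂ ℕ.+ length X₃    ≡⟨ cong₂ ℕ._+_ (cong₂ ℕ._+_ (length-⟦⟧⊙ _ (A S)) (length-⟦⟧⊙ _ (A T)))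
                                                            (trans (length-⟦⟧⊙ _ (gg · J)) (length-· gg J)) ⟩
  n S ℕ.+ n T ℕ.+ gg ℕ.* 1                 ≡⟨ cong (n S ℕ.+ n T ℕ.+_) (ℕ.*-identityʳ gg) ⟩
  n S ℕ.+ n T ℕ.+ gg                       ∎
  where
    open ≡-Reasoning
    gg = g S ℕ.* g T
    J  = ⟦ jokers (α S) ⟧
    X₁ = [0] ⊙ A S
    X₂ = [0] ⊙ A T
    X₃ = [1] ⊙ (gg · J)

g-⊗ : ∀ S T → g (S ⊗ T) ≡ g S ℕ.+ g T
g-⊗ S T = begin
  length (Y₁ ++ Y₂)            ≡⟨ length-++ Y₁ ⟩
  length Y₁ ℕ.+ length Y₂      ≡⟨ cong₂ ℕ._+_ (trans (length-⊙⟦⟧ ([0] ⊙ C S) _) (length-⟦⟧⊙ _ (C S)))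
                                                (length-⊙ ([1] ⊙ ⟦ jokers (β S) ⟧) (C T)) ⟩
  g S ℕ.+ 1 ℕ.* g T            ≡⟨ cong (g S ℕ.+_) (ℕ.*-identityˡ (g T)) ⟩
  g S ℕ.+ g T                  ∎
  where
    open ≡-Reasoning
    Y₁ = [0] ⊙ C S ⊙ ⟦ jokers (β T) ⟧
    Y₂ = [1] ⊙ ⟦ jokers (β S) ⟧ ⊙ C T

α-⊗ : ∀ S T → NonEmpty (A S) → α (S ⊗ T) ≡ ℕ.suc (α S)
α-⊗ _ _ (_ ∷ _) = refl

β-⊗ : ∀ S T → NonEmpty (B S) → β (S ⊗ T) ≡ ℕ.suc (β S ℕ.+ β T)
β-⊗ _ T (b ∷ _) = cong ℕ.suc (trans (length-++ b) (cong (length b ℕ.+_) (length-replicate (β T))))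

A-⊗-nonEmpty : ∀ S T → NonEmpty (A S) → NonEmpty (A (S ⊗ T))
A-⊗-nonEmpty _ _ (_ ∷ _) = _ ∷ _

B-⊗-nonEmpty : ∀ S T → NonEmpty (B S) → NonEmpty (B (S ⊗ T))
B-⊗-nonEmpty _ _ (_ ∷ _) = _ ∷ _

2n+g≡g²+12p-additive : ∀ p nS gS nT gT →
  2 ℕ.* nS ℕ.+ gS ≡ gS ℕ.* gS ℕ.+ 12 ℕ.* p →
  2 ℕ.* nT ℕ.+ gT ≡ gT ℕ.* gT ℕ.+ 12 ℕ.* p →
  2 ℕ.* (nS ℕ.+ nT ℕ.+ gS ℕ.* gT) ℕ.+ (gS ℕ.+ gT) ≡ (gS ℕ.+ gT) ℕ.* (gS ℕ.+ gT) ℕ.+ 12 ℕ.* (2 ℕ.* p)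
2n+g≡g²+12p-additive p nS gS nT gT hS hT = begin
  2 ℕ.* (nS ℕ.+ nT ℕ.+ gS ℕ.* gT) ℕ.+ (gS ℕ.+ gT)
    ≡⟨ regroup nS gS nT gT ⟩
  (2 ℕ.* nS ℕ.+ gS) ℕ.+ (2 ℕ.* nT ℕ.+ gT) ℕ.+ 2 ℕ.* gS ℕ.* gT
    ≡⟨ cong₂ (λ u v → u ℕ.+ v ℕ.+ 2 ℕ.* gS ℕ.* gT) hS hT ⟩
  (gS ℕ.* gS ℕ.+ 12 ℕ.* p) ℕ.+ (gT ℕ.* gT ℕ.+ 12 ℕ.* p) ℕ.+ 2 ℕ.* gS ℕ.* gT
    ≡⟨ complete-square p gS gT ⟩
  (gS ℕ.+ gT) ℕ.* (gS ℕ.+ gT) ℕ.+ 12 ℕ.* (2 ℕ.* p) ∎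
  where
    open ≡-Reasoning
    regroup : ∀ nS gS nT gT → 2 ℕ.* (nS ℕ.+ nT ℕ.+ gS ℕ.* gT) ℕ.+ (gS ℕ.+ gT)
                            ≡ (2 ℕ.* nS ℕ.+ gS) ℕ.+ (2 ℕ.* nT ℕ.+ gT) ℕ.+ 2 ℕ.* gS ℕ.* gT
    regroup = ℕ-Solver.solve-∀
    complete-square : ∀ p gS gT → (gS ℕ.* gS ℕ.+ 12 ℕ.* p) ℕ.+ (gT ℕ.* gT ℕ.+ 12 ℕ.* p) ℕ.+ 2 ℕ.* gS ℕ.* gT
                                ≡ (gS ℕ.+ gT) ℕ.* (gS ℕ.+ gT) ℕ.+ 12 ℕ.* (2 ℕ.* p)
    complete-square = ℕ-Solver.solve-∀

record Shape (k : ℕ) (T : Triple) : Set where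
  field
    A-nonEmpty     : NonEmpty (A T)
    B-nonEmpty     : NonEmpty (B T)
    α≡2+k          : α T ≡ 2 ℕ.+ k
    1+β≡g          : ℕ.suc (β T) ≡ g T
    2n+g≡g²+12·2^k : 2 ℕ.* n T ℕ.+ g T ≡ g T ℕ.* g T ℕ.+ 12 ℕ.* 2 ℕ.^ k
open Shape

1+β≡g-⊗ : ∀ {k S} T → Shape k S → Shape k T → ℕ.suc (β (S ⊗ T)) ≡ g (S ⊗ T)
1+β≡g-⊗ {S = S} T shS shT = begin
  ℕ.suc (β (S ⊗ T))              ≡⟨ cong ℕ.suc (β-⊗ S T (B-nonEmpty shS)) ⟩
  ℕ.suc (ℕ.suc (β S ℕ.+ β T))    ≡⟨ cong ℕ.suc (sym (ℕ.+-suc (β S) (β T))) ⟩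
  ℕ.suc (β S) ℕ.+ ℕ.suc (β T)    ≡⟨ cong₂ ℕ._+_ (1+β≡g shS) (1+β≡g shT) ⟩
  g S ℕ.+ g T                    ≡⟨ sym (g-⊗ S T) ⟩
  g (S ⊗ T)                      ∎
  where open ≡-Reasoning

2n+g≡g²+12·2^k-⊗ : ∀ {k S} T → Shape k S → Shape k T →
  2 ℕ.* n (S ⊗ T) ℕ.+ g (S ⊗ T) ≡ g (S ⊗ T) ℕ.* g (S ⊗ T) ℕ.+ 12 ℕ.* 2 ℕ.^ ℕ.suc k
2n+g≡g²+12·2^k-⊗ {k} {S} T shS shT = begin
  2 ℕ.* n (S ⊗ T) ℕ.+ g (S ⊗ T)
    ≡⟨ cong₂ (λ m h → 2 ℕ.* m ℕ.+ h) (n-⊗ S T) (g-⊗ S T) ⟩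
  2 ℕ.* (n S ℕ.+ n T ℕ.+ g S ℕ.* g T) ℕ.+ (g S ℕ.+ g T)
    ≡⟨ 2n+g≡g²+12p-additive (2 ℕ.^ k) (n S) (g S) (n T) (g T) (2n+g≡g²+12·2^k shS) (2n+g≡g²+12·2^k shT) ⟩
  (g S ℕ.+ g T) ℕ.* (g S ℕ.+ g T) ℕ.+ 12 ℕ.* 2 ℕ.^ ℕ.suc k
    ≡⟨ cong (λ h → h ℕ.* h ℕ.+ 12 ℕ.* 2 ℕ.^ ℕ.suc k) (sym (g-⊗ S T)) ⟩
  g (S ⊗ T) ℕ.* g (S ⊗ T) ℕ.+ 12 ℕ.* 2 ℕ.^ ℕ.suc k ∎
  where open ≡-Reasoning

shape : ∀ {k T} → 𝒯 k T → Shape k T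
shape base♭ = record { A-nonEmpty = _ ∷ _ ; B-nonEmpty = _ ∷ _ ; α≡2+k = refl ; 1+β≡g = refl ; 2n+g≡g²+12·2^k = refl }
shape base† = record { A-nonEmpty = _ ∷ _ ; B-nonEmpty = _ ∷ _ ; α≡2+k = refl ; 1+β≡g = refl ; 2n+g≡g²+12·2^k = refl }
shape base‡ = record { A-nonEmpty = _ ∷ _ ; B-nonEmpty = _ ∷ _ ; α≡2+k = refl ; 1+β≡g = refl ; 2n+g≡g²+12·2^k = refl }
shape base♯ = record { A-nonEmpty = _ ∷ _ ; B-nonEmpty = _ ∷ _ ; α≡2+k = refl ; 1+β≡g = refl ; 2n+g≡g²+12·2^k = refl }
shape (step {S = S} {T = T} s t _) = record
  { A-nonEmpty     = A-⊗-nonEmpty S T (A-nonEmpty shS)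
  ; B-nonEmpty     = B-⊗-nonEmpty S T (B-nonEmpty shS)
  ; α≡2+k          = trans (α-⊗ S T (A-nonEmpty shS)) (cong ℕ.suc (α≡2+k shS))
  ; 1+β≡g          = 1+β≡g-⊗ T shS shT
  ; 2n+g≡g²+12·2^k = 2n+g≡g²+12·2^k-⊗ T shS shT
  }
  where
    shS = shape s
    shT = shape t

δ≡g+k+1 : ∀ {k T} → Shape k T → δ T ≡ g T ℕ.+ k ℕ.+ 1
δ≡g+k+1 {k} {T} sh = begin
  α T ℕ.+ β T                  ≡⟨ cong₂ ℕ._+_ (α≡2+k sh) refl ⟩
  2 ℕ.+ k ℕ.+ β T              ≡⟨ shuffle k (β T) ⟩
  ℕ.suc (β T) ℕ.+ k ℕ.+ 1      ≡⟨ cong (λ h → h ℕ.+ k ℕ.+ 1) (1+β≡g sh) ⟩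
  g T ℕ.+ k ℕ.+ 1              ∎
  where
    open ≡-Reasoning
    shuffle : ∀ k b → 2 ℕ.+ k ℕ.+ b ≡ ℕ.suc b ℕ.+ k ℕ.+ 1
    shuffle = ℕ-Solver.solve-∀

4^k≡2^k*2^k : ∀ k → 4 ℕ.^ k ≡ 2 ℕ.^ k ℕ.* 2 ℕ.^ k
4^k≡2^k*2^k ℕ.zero    = refl
4^k≡2^k*2^k (ℕ.suc k) = trans (cong (4 ℕ.*_) (4^k≡2^k*2^k k)) (shuffle (2 ℕ.^ k))
  where
    shuffle : ∀ p → 4 ℕ.* (p ℕ.* p) ≡ (2 ℕ.* p) ℕ.* (2 ℕ.* p)
    shuffle = ℕ-Solver.solve-∀

pos-+-+1 : ∀ a b → + (a ℕ.+ b ℕ.+ 1) ≡ + a + + b + + 1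
pos-+-+1 a b = trans (pos-+ (a ℕ.+ b) 1) (cong (_+ + 1) (pos-+ a b))

g♭≡3·2^k : ∀ k → + g♭ k ≡ + 3 * + (2 ℕ.^ k)
g♭≡3·2^k k = pos-* 3 (2 ℕ.^ k)

δ♭≡3·2^k+k+1 : ∀ k → + δ♭ k ≡ + 3 * + (2 ℕ.^ k) + + k + + 1
δ♭≡3·2^k+k+1 k = trans (pos-+-+1 (g♭ k) k) (cong (λ z → z + + k + + 1) (g♭≡3·2^k k))

twice-n♭≡9·2^k·2^k+9·2^k : ∀ k → + twice-n♭ k ≡ + 9 * (+ (2 ℕ.^ k) * + (2 ℕ.^ k)) + + 9 * + (2 ℕ.^ k)
twice-n♭≡9·2^k·2^k+9·2^k k =
  trans (pos-+ (9 ℕ.* 4 ℕ.^ k) (9 ℕ.* 2 ℕ.^ k)) (cong₂ _+_ 9·4^k (pos-* 9 (2 ℕ.^ k)))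
  where
    9·4^k : + (9 ℕ.* 4 ℕ.^ k) ≡ + 9 * (+ (2 ℕ.^ k) * + (2 ℕ.^ k))
    9·4^k = trans (cong (λ m → + (9 ℕ.* m)) (4^k≡2^k*2^k k))
                  (trans (pos-* 9 (2 ℕ.^ k ℕ.* 2 ℕ.^ k)) (cong (+ 9 *_) (pos-* (2 ℕ.^ k) (2 ℕ.^ k))))

2n+g≡g²+12·2^k-ℤ : ∀ {k T} → Shape k T → + 2 * + n T + + g T ≡ + g T * + g T + + 12 * + (2 ℕ.^ k)
2n+g≡g²+12·2^k-ℤ {k} {T} sh = begin
  + 2 * + n T + + g T                   ≡⟨ cong (_+ + g T) (pos-* 2 (n T)) ⟨
  + (2 ℕ.* n T) + + g T                 ≡⟨ pos-+ (2 ℕ.* n T) (g T) ⟨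
  + (2 ℕ.* n T ℕ.+ g T)                 ≡⟨ cong +_ (2n+g≡g²+12·2^k sh) ⟩
  + (g T ℕ.* g T ℕ.+ 12 ℕ.* 2 ℕ.^ k)    ≡⟨ pos-+ (g T ℕ.* g T) (12 ℕ.* 2 ℕ.^ k) ⟩
  + (g T ℕ.* g T) + + (12 ℕ.* 2 ℕ.^ k)  ≡⟨ cong₂ _+_ (pos-* (g T) (g T)) (pos-* 12 (2 ℕ.^ k)) ⟩
  + g T * + g T + + 12 * + (2 ℕ.^ k)    ∎
  where open ≡-Reasoning

δ≡g+k+1-ℤ : ∀ {k T} → Shape k T → + δ T ≡ + g T + + k + + 1
δ≡g+k+1-ℤ {k} {T} sh = trans (cong +_ (δ≡g+k+1 sh)) (pos-+-+1 (g T) k)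

closed-forms : ∀ N G K P {D tw gb db : ℤ} →
  + 2 * N + G ≡ G * G + + 12 * P → D ≡ G + K + + 1 →
  tw ≡ + 9 * (P * P) + + 9 * P → gb ≡ + 3 * P → db ≡ + 3 * P + K + + 1 →
  let x = D - db
  in (+ 2 * N ≡ tw + + 2 * gb * x + x * (x - + 1)) × (G ≡ gb + x) × (G ≡ D - K - + 1)
closed-forms N G K P 2N+G≡G²+12P refl refl refl refl =
  (begin
    + 2 * N                   ≡⟨ cancel-G N G ⟩
    + 2 * N + G - G           ≡⟨ cong (_- G) 2N+G≡G²+12P ⟩
    G * G + + 12 * P - G      ≡⟨ expand-in-excess G K P ⟩
    _                         ∎) ,
  g-in-excess G K P ,
  g-in-d G K
  where
    open ≡-Reasoning
    cancel-G : ∀ N G → + 2 * N ≡ + 2 * N + G - G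
    cancel-G = solve-∀
    expand-in-excess : ∀ G K P →
      let x = G + K + + 1 - (+ 3 * P + K + + 1)
      in G * G + + 12 * P - G ≡ + 9 * (P * P) + + 9 * P + + 2 * (+ 3 * P) * x + x * (x - + 1)
    expand-in-excess = solve-∀
    g-in-excess : ∀ G K P → G ≡ + 3 * P + (G + K + + 1 - (+ 3 * P + K + + 1))
    g-in-excess = solve-∀
    g-in-d : ∀ G K → G ≡ G + K + + 1 - K - + 1
    g-in-d = solve-∀

proposition9 : (k : ℕ) (T : Triple) → 𝒯 k T →
    let d = δ T
        x = + d - + δ♭ k
    in (+ 2 * + n T ≡ + twice-n♭ k + + 2 * + g♭ k * x + x * (x - + 1))
       × (+ g T ≡ + g♭ k + x)
       × (+ g T ≡ + d - + k - + 1)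
proposition9 k T t =
  closed-forms (+ n T) (+ g T) (+ k) (+ (2 ℕ.^ k))
    (2n+g≡g²+12·2^k-ℤ sh) (δ≡g+k+1-ℤ sh)
    (twice-n♭≡9·2^k·2^k+9·2^k k) (g♭≡3·2^k k) (δ♭≡3·2^k+k+1 k)
  where sh = shape t
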